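{- For any graph $X$ and any functor $F\colon\Pi_1X\to\mathsf{Set}$, the projection $p\colon\mathsf{Tot}_XF\to X$ is a covering map.
   Context: Graphs are simple undirected loopless graphs; graph maps send adjacent vertices to equal or adjacent vertices. $I_n$ has vertices $0,\dots,n$, edges $i\sim i+1$; $I_1\square I_1$ is the $4$-cycle on $\{0,1\}^2$, adjacent iff differing in one coordinate. The fundamental groupoid $\Pi_1X$ has objects the vertices of $X$ and morphisms $x\to x'$ the path-homotopy classes $[\gamma]$ of paths $\gamma\colon I_n\to X$ from $x$ to $x'$ (path-components of the quotient of $\coprod_nP_nX(x,x')$ by reparametrization along surjective order-preserving graph maps $I_m\to I_n$; $P_nX(x,x')$ has paths of length $n$ as vertices, adjacent iff distinct and pointwise equal-or-adjacent), with $[\sigma]\circ[\gamma]=[\gamma\ast\sigma]$ (concatenation). The total graph $\mathsf{Tot}_XF$ has vertex set $\coprod_{x\in V(X)}Fx$; $y\in Fx$ and $y'\in Fx'$ are adjacent iff $x\sim x'$ in $X$ and $F[e](y)=y'$, where $e\colon I_1\to X$ is $e(0)=x$, $e(1)=x'$; the projection $p$ sends $y\in Fx$ to $x$. A graph map $q\colon Y\to X$ is a covering map if (i) for every vertex $y$, $q$ restricts to a bijection from $y$ together with its neighbours onto $q(y)$ together with its neighbours, and (ii) for all graph maps $u\colon I_3\to Y$, $v\colon I_1\square I_1\to X$ with $q(u(0))=v(1,0)$, $q(u(1))=v(0,0)$, $q(u(2))=v(0,1)$, $q(u(3))=v(1,1)$, one has $u(0)=u(3)$ or $u(0)\sim u(3)$.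 -}

module Defs where

open import Level using (0ℓ)
open import Data.Nat using (ℕ; zero; suc; _+_)
open import Data.Fin using (Fin; zero; suc; toℕ; fromℕ; splitAt; #_)
import Data.Fin as Fin
open import Data.Product using (Σ; _×_; _,_; proj₁; proj₂)
open import Data.Sum using (_⊎_; inj₁; inj₂; [_,_]′)
open import Data.Empty using (⊥)
open import Function using (_∘_; id)
open import Relation.Nullary using (¬_)
open import Relation.Binary.PropositionalEquality using (_≡_; refl; _≗_)
open import Relation.Binary.Construct.Closure.Equivalence using (EqClosure)

record Graph : Set₁ where
  field
    V   : Set
    _∼_ : V → V → Set

open Graph public

record IsSimpleGraph (G : Graph) : Set where
  field
    sym    : ∀ {x y} → _∼_ G x y → _∼_ G y x
    irrefl : ∀ {x} → ¬ (_∼_ G x x)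

open IsSimpleGraph public

IsGraphMap : (G H : Graph) → (V G → V H) → Set
IsGraphMap G H f = ∀ {x y} → _∼_ G x y → f x ≡ f y ⊎ _∼_ H (f x) (f y)

N[_] : (G : Graph) → V G → V G → Set
N[ G ] y y' = y' ≡ y ⊎ _∼_ G y y'

I : ℕ → Graph
I n = record
  { V   = Fin (suc n)
  ; _∼_ = λ i j → toℕ j ≡ suc (toℕ i) ⊎ toℕ i ≡ suc (toℕ j)
  }

_□_ : Graph → Graph → Graph
G □ H = record
  { V   = V G × V H
  ; _∼_ = λ p q → (proj₁ p ≡ proj₁ q × _∼_ H (proj₂ p) (proj₂ q))
                ⊎ (_∼_ G (proj₁ p) (proj₁ q) × proj₂ p ≡ proj₂ q)
  }

I₁□I₁ : Graph
I₁□I₁ = I 1 □ I 1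

record Path (X : Graph) (x x' : V X) (n : ℕ) : Set where
  field
    map   : Fin (suc n) → V X
    isMap : IsGraphMap (I n) X map
    start : map zero ≡ x
    end   : map (fromℕ n) ≡ x'

open Path public

concat : ∀ {A : Set} {n m} → (Fin (suc n) → A) → (Fin (suc m) → A)
       → Fin (suc (n + m)) → A
concat {n = n} {m} γ σ = [ γ , (λ j → σ (suc j)) ]′ ∘ splitAt (suc n) {m}

Paths : (X : Graph) → V X → V X → Set
Paths X x x' = Σ ℕ (Path X x x')

IsReparam : ∀ {m n} → (Fin (suc m) → Fin (suc n)) → Set
IsReparam {m} {n} r =
    (∀ j → Σ (Fin (suc m)) λ i → r i ≡ j)
  × (∀ {i j} → i Fin.≤ j → r i Fin.≤ r j)
  × IsGraphMap (I m) (I n) r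

data HStep (X : Graph) {x x' : V X} : Paths X x x' → Paths X x x' → Set where
  adj     : ∀ {n} (γ γ' : Path X x x' n)
          → (∀ i → map γ i ≡ map γ' i ⊎ _∼_ X (map γ i) (map γ' i))
          → HStep X (n , γ) (n , γ')
  reparam : ∀ {n m} (γ : Path X x x' n) (γ' : Path X x x' m)
              (r : Fin (suc m) → Fin (suc n)) → IsReparam r
          → (∀ i → map γ' i ≡ map γ (r i))
          → HStep X (n , γ) (m , γ')

-- Path homotopy: the equivalence relation generated by HStep
-- (path-components of the quotient by reparametrization).
Homotopic : (X : Graph) {x x' : V X} → Paths X x x' → Paths X x x' → Set
Homotopic X = EqClosure (HStep X)

-- Functors Π₁X → Set, given on representatives and respecting homotopy.

record Functor (X : Graph) : Set₁ where
  field
    obj  : V X → Set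
    hom  : ∀ {x x' n} → Path X x x' n → obj x → obj x'
    resp : ∀ {x x'} {p q : Paths X x x'} → Homotopic X p q
         → hom (proj₂ p) ≗ hom (proj₂ q)
    hom-id : ∀ {x} (ε : Path X x x 0) → hom ε ≗ id
    hom-∘  : ∀ {x x' x'' n m} (γ : Path X x x' n) (σ : Path X x' x'' m)
               (τ : Path X x x'' (n + m))
           → map τ ≗ concat (map γ) (map σ)
           → hom τ ≗ hom σ ∘ hom γ

open Functor public

module _ (X : Graph) (s : IsSimpleGraph X) where

  edgeMap : ∀ {x x'} → _∼_ X x x' → Fin 2 → V X
  edgeMap {x} {x'} _ zero    = x
  edgeMap {x} {x'} _ (suc _) = x'

  edgeIsMap : ∀ {x x'} (h : _∼_ X x x') → IsGraphMap (I 1) X (edgeMap h)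
  edgeIsMap h {zero}        {zero}        (inj₁ ())
  edgeIsMap h {zero}        {zero}        (inj₂ ())
  edgeIsMap h {zero}        {suc zero}    _ = inj₂ h
  edgeIsMap h {suc zero}    {zero}        _ = inj₂ (sym s h)
  edgeIsMap h {suc zero}    {suc zero}    (inj₁ ())
  edgeIsMap h {suc zero}    {suc zero}    (inj₂ ())

  edge : ∀ {x x'} → _∼_ X x x' → Path X x x' 1
  edge h = record { map = edgeMap h ; isMap = edgeIsMap h ; start = refl ; end = refl }

  Tot : Functor X → Graph
  Tot F = record
    { V   = Σ (V X) (obj F)
    ; _∼_ = λ p q → Σ (_∼_ X (proj₁ p) (proj₁ q)) λ h → hom F (edge h) (proj₂ p) ≡ proj₂ q
    }

  proj : (F : Functor X) → V (Tot F) → V X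
  proj F = proj₁

record IsCoveringMap (Y X : Graph) (q : V Y → V X) : Set where
  field
    isGraphMap : IsGraphMap Y X q
    -- (i) q restricts to a bijection N[y] → N[q y]
    locInj  : ∀ y {y₁ y₂} → N[ Y ] y y₁ → N[ Y ] y y₂ → q y₁ ≡ q y₂ → y₁ ≡ y₂
    locSurj : ∀ y {x} → N[ X ] (q y) x → Σ (V Y) λ y' → N[ Y ] y y' × q y' ≡ x
    square  : (u : V (I 3) → V Y) (v : V I₁□I₁ → V X)
            → IsGraphMap (I 3) Y u → IsGraphMap I₁□I₁ X v
            → q (u (# 0)) ≡ v (# 1 , # 0)
            → q (u (# 1)) ≡ v (# 0 , # 0)
            → q (u (# 2)) ≡ v (# 0 , # 1)
            → q (u (# 3)) ≡ v (# 1 , # 1)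
            → u (# 0) ≡ u (# 3) ⊎ _∼_ Y (u (# 0)) (u (# 3))

-- A functor on Π₁X transports along homotopy classes of paths, and everything
-- reduces to three homotopy facts: a path staying pointwise within one step of
-- another acts the same; a path that stays at one vertex acts as the identity;
-- and the path x, x, x', x' is a reparametrisation of the edge x ∼ x'.
-- Symmetry of Tot comes from the null-homotopic path x, x', x.  Local bijectivity
-- holds because the edges above x ∼ x' out of (x , a) are exactly (x' , F[e] a).
-- For the square condition, transport along the projection of a lifted path
-- carries the fibre element at its start to the one at its end; the square in X
-- makes the projection x₀ x₁ x₂ x₃ of u homotopic (via x₀ x₀ x₃ x₃) to the
-- single step x₀ x₃, so transport along that step takes u 0 to u 3, which is
-- precisely adjacency (or equality) in Tot.
module Submission where

open import Defs hiding (sym)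
open import Data.Product using (Σ; _×_; _,_; proj₁; proj₂)
open import Data.Nat using (zero; suc; z≤n; s≤s)
import Data.Nat as ℕ
open import Data.Fin using (Fin; zero; suc; fromℕ; inject₁; #_)
import Data.Fin as Fin
open import Data.Sum using (_⊎_; inj₁; inj₂; swap)
import Data.Sum as Sum
open import Data.Empty using (⊥-elim)
open import Function using (_∘_; id)
open import Relation.Binary.Definitions using (Symmetric)
open import Relation.Binary.PropositionalEquality
  using (_≡_; refl; sym; trans; cong; subst; subst₂; _≗_; module ≡-Reasoning)
open import Relation.Binary.Construct.Closure.ReflexiveTransitive using (ε; _◅_)
open import Relation.Binary.Construct.Closure.Symmetric using (fwd)

EqOrAdj : (G : Graph) → V G → V G → Set
EqOrAdj G a b = a ≡ b ⊎ _∼_ G a b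

EqOrAdj-sym : (G : Graph) → Symmetric (_∼_ G) → Symmetric (EqOrAdj G)
EqOrAdj-sym G ∼-sym = Sum.map sym ∼-sym

∘-isGraphMap : ∀ {G H K : Graph} {g : V H → V K} {f : V G → V H}
             → IsGraphMap H K g → IsGraphMap G H f → IsGraphMap G K (g ∘ f)
∘-isGraphMap {g = g} g-map f-map x∼y with f-map x∼y
... | inj₁ fx≡fy = inj₁ (cong g fx≡fy)
... | inj₂ fx∼fy = g-map fx∼fy

suc-isGraphMap : ∀ {n} → IsGraphMap (I n) (I (suc n)) suc
suc-isGraphMap = inj₂ ∘ Sum.map (cong suc) (cong suc)

steps⇒isGraphMap : ∀ (G : Graph) → Symmetric (_∼_ G) → ∀ n (f : Fin (suc n) → V G)
                 → (∀ (i : Fin n) → EqOrAdj G (f (inject₁ i)) (f (suc i)))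
                 → IsGraphMap (I n) G f
steps⇒isGraphMap G ∼-sym n       f step {zero}        {zero}        (inj₁ ())
steps⇒isGraphMap G ∼-sym n       f step {zero}        {zero}        (inj₂ ())
steps⇒isGraphMap G ∼-sym (suc n) f step {zero}        {suc zero}    _ = step zero
steps⇒isGraphMap G ∼-sym (suc n) f step {zero}        {suc (suc j)} (inj₁ ())
steps⇒isGraphMap G ∼-sym (suc n) f step {zero}        {suc (suc j)} (inj₂ ())
steps⇒isGraphMap G ∼-sym (suc n) f step {suc zero}    {zero}        _ =
  EqOrAdj-sym G ∼-sym (step zero)
steps⇒isGraphMap G ∼-sym (suc n) f step {suc (suc i)} {zero}        (inj₁ ())
steps⇒isGraphMap G ∼-sym (suc n) f step {suc (suc i)} {zero}        (inj₂ ())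
steps⇒isGraphMap G ∼-sym (suc n) f step {suc i}       {suc j}       i∼j =
  steps⇒isGraphMap G ∼-sym n (f ∘ suc) (step ∘ suc) (Sum.map (cong ℕ.pred) (cong ℕ.pred) i∼j)

module _ {X : Graph} (F : Functor X) where

  hom-step : ∀ {x x'} {p q : Paths X x x'} → HStep X p q → hom F (proj₂ p) ≗ hom F (proj₂ q)
  hom-step st = resp F (fwd st ◅ ε)

  constPath : ∀ x n → Path X x x n
  constPath x n = record { map = λ _ → x ; isMap = λ _ → inj₁ refl ; start = refl ; end = refl }

  hom-const : ∀ {x n} (γ : Path X x x n) → (∀ i → map γ i ≡ x) → hom F γ ≗ id
  hom-const {x} γ γ≡x a = begin
      hom F γ a                  ≡⟨ hom-step collapse a ⟨
      hom F (constPath x 0) a    ≡⟨ hom-id F (constPath x 0) a ⟩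
      a                          ∎
    where
    open ≡-Reasoning
    collapse : HStep X (0 , constPath x 0) (_ , γ)
    collapse = reparam (constPath x 0) γ (λ _ → zero)
                 ((λ { zero → zero , refl }) , (λ _ → z≤n) , (λ _ → inj₁ refl)) γ≡x

  hom-adj : ∀ {x x' n} (γ γ' : Path X x x' n) → (∀ i → EqOrAdj X (map γ i) (map γ' i))
          → hom F γ ≗ hom F γ'
  hom-adj γ γ' γ≈γ' = hom-step (adj γ γ' γ≈γ')

  hom-null : ∀ {x n} (γ : Path X x x n) → (∀ i → EqOrAdj X (map γ i) x) → hom F γ ≗ id
  hom-null {x} {n} γ γ≈x a =
    trans (hom-adj γ (constPath x n) γ≈x a) (hom-const (constPath x n) (λ _ → refl) a)

  hom-path₁-unique : ∀ {x x'} (σ σ' : Path X x x' 1) → hom F σ ≗ hom F σ'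
  hom-path₁-unique σ σ' = hom-adj σ σ' λ
    { zero       → inj₁ (trans (start σ) (sym (start σ')))
    ; (suc zero) → inj₁ (trans (end σ) (sym (end σ')))
    }

  hom-loop₁ : ∀ {x} (σ : Path X x x 1) → hom F σ ≗ id
  hom-loop₁ σ = hom-const σ λ { zero → start σ ; (suc zero) → end σ }

module _ (X : Graph) (s : IsSimpleGraph X) (F : Functor X) where

  private
    ∼-sym : Symmetric (_∼_ X)
    ∼-sym = IsSimpleGraph.sym s

    T : Graph
    T = Tot X s F

  segment : ∀ {x x'} → EqOrAdj X x x' → Path X x x' 1
  segment {x} {x'} x≈x' = record
    { map   = endpoints
    ; isMap = steps⇒isGraphMap X ∼-sym 1 endpoints λ { zero → x≈x' }
    ; start = refl
    ; end   = refl
    }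
    where
    endpoints : Fin 2 → V X
    endpoints zero    = x
    endpoints (suc _) = x'

  hom-collapse₃ : ∀ {x x'} (π : Path X x x' 3) (x≈x' : EqOrAdj X x x')
                → EqOrAdj X (map π (# 1)) x → EqOrAdj X (map π (# 2)) x'
                → hom F π ≗ hom F (segment x≈x')
  hom-collapse₃ {x} {x'} π x≈x' π₁≈x π₂≈x' a =
    trans (hom-adj F π ρ π≈ρ a) (sym (hom-step F σ-to-ρ a))
    where
    stutter : Fin 4 → V X
    stutter zero          = x
    stutter (suc zero)    = x
    stutter (suc (suc _)) = x'

    ρ : Path X x x' 3
    ρ = record
      { map   = stutter
      ; isMap = steps⇒isGraphMap X ∼-sym 3 stutter
                  λ { zero → inj₁ refl ; (suc zero) → x≈x' ; (suc (suc zero)) → inj₁ refl }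
      ; start = refl
      ; end   = refl
      }

    π≈ρ : ∀ i → EqOrAdj X (map π i) (map ρ i)
    π≈ρ zero                   = inj₁ (start π)
    π≈ρ (suc zero)             = π₁≈x
    π≈ρ (suc (suc zero))       = π₂≈x'
    π≈ρ (suc (suc (suc zero))) = inj₁ (end π)

    r : Fin 4 → Fin 2
    r zero          = zero
    r (suc zero)    = zero
    r (suc (suc _)) = suc zero

    r-mono : ∀ {i j} → i Fin.≤ j → r i Fin.≤ r j
    r-mono {zero}        _ = z≤n
    r-mono {suc zero}    _ = z≤n
    r-mono {suc (suc i)} {suc (suc j)} _ = s≤s z≤n
    r-mono {suc (suc i)} {suc zero} (s≤s ())

    r-reparam : IsReparam r
    r-reparam = (λ { zero → zero , refl ; (suc zero) → # 2 , refl })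
              , r-mono
              , steps⇒isGraphMap (I 1) swap 3 r
                  λ { zero → inj₁ refl ; (suc zero) → inj₂ (inj₁ refl) ; (suc (suc zero)) → inj₁ refl }

    ρ≡σ∘r : ∀ i → stutter i ≡ map (segment x≈x') (r i)
    ρ≡σ∘r zero          = refl
    ρ≡σ∘r (suc zero)    = refl
    ρ≡σ∘r (suc (suc _)) = refl

    σ-to-ρ : HStep X (1 , segment x≈x') (3 , ρ)
    σ-to-ρ = reparam (segment x≈x') ρ r r-reparam ρ≡σ∘r

  Tot-sym : Symmetric (_∼_ T)
  Tot-sym {x , a} {x' , b} (x∼x' , e[a]≡b) = ∼-sym x∼x' , (begin
      hom F back b                    ≡⟨ cong (hom F back) e[a]≡b ⟨
      hom F back (hom F forth a)      ≡⟨ hom-∘ F forth back there-and-back split a ⟨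
      hom F there-and-back a          ≡⟨ hom-null F there-and-back near-x a ⟩
      a                               ∎)
    where
    open ≡-Reasoning
    forth : Path X x x' 1
    forth = edge X s x∼x'

    back : Path X x' x 1
    back = edge X s (∼-sym x∼x')

    there-and-back : Path X x x 2
    there-and-back = record
      { map   = λ { zero → x ; (suc zero) → x' ; (suc (suc zero)) → x }
      ; isMap = steps⇒isGraphMap X ∼-sym 2 _ λ { zero → inj₂ x∼x' ; (suc zero) → inj₂ (∼-sym x∼x') }
      ; start = refl
      ; end   = refl
      }

    split : map there-and-back ≗ concat (map forth) (map back)
    split zero             = refl
    split (suc zero)       = refl
    split (suc (suc zero)) = refl

    near-x : ∀ i → EqOrAdj X (map there-and-back i) x
    near-x zero             = inj₁ refl
    near-x (suc zero)       = inj₂ (∼-sym x∼x')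
    near-x (suc (suc zero)) = inj₁ refl

  Tot-isSimpleGraph : IsSimpleGraph T
  Tot-isSimpleGraph = record { sym = Tot-sym ; irrefl = λ (x∼x , _) → IsSimpleGraph.irrefl s x∼x }

  proj-isGraphMap : IsGraphMap T X proj₁
  proj-isGraphMap (x∼x' , _) = inj₂ x∼x'

  step⇒hom≡ : ∀ {y y'} → EqOrAdj T y y' → (σ : Path X (proj₁ y) (proj₁ y') 1)
            → hom F σ (proj₂ y) ≡ proj₂ y'
  step⇒hom≡ (inj₁ refl) σ = hom-loop₁ F σ _
  step⇒hom≡ (inj₂ (x∼x' , e[a]≡b)) σ = trans (hom-path₁-unique F σ (edge X s x∼x') _) e[a]≡b

  hom≡⇒step : ∀ {y y'} → EqOrAdj X (proj₁ y) (proj₁ y') → (σ : Path X (proj₁ y) (proj₁ y') 1)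
            → hom F σ (proj₂ y) ≡ proj₂ y' → EqOrAdj T y y'
  hom≡⇒step {x , a} (inj₁ refl) σ σ[a]≡b = inj₁ (cong (x ,_) (trans (sym (hom-loop₁ F σ a)) σ[a]≡b))
  hom≡⇒step (inj₂ x∼x') σ σ[a]≡b =
    inj₂ (x∼x' , trans (hom-path₁-unique F (edge X s x∼x') σ _) σ[a]≡b)

  projectPath : ∀ {n} (u : Fin (suc n) → V T) → IsGraphMap (I n) T u
              → Path X (proj₁ (u zero)) (proj₁ (u (fromℕ n))) n
  projectPath u u-map = record
    { map   = proj₁ ∘ u
    ; isMap = ∘-isGraphMap {I _} {T} {X} proj-isGraphMap u-map
    ; start = refl
    ; end   = refl
    }

  hom-projectPath : ∀ n (u : Fin (suc n) → V T) (u-map : IsGraphMap (I n) T u)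
                  → hom F (projectPath u u-map) (proj₂ (u zero)) ≡ proj₂ (u (fromℕ n))
  hom-projectPath zero    u u-map = hom-id F (projectPath u u-map) _
  hom-projectPath (suc n) u u-map = begin
      hom F (projectPath u u-map) (proj₂ (u zero))  ≡⟨ hom-∘ F first rest (projectPath u u-map) split _ ⟩
      hom F rest (hom F first (proj₂ (u zero)))     ≡⟨ cong (hom F rest) (step⇒hom≡ u₀≈u₁ first) ⟩
      hom F rest (proj₂ (u (suc zero)))             ≡⟨ hom-projectPath n (u ∘ suc) tail-map ⟩
      proj₂ (u (fromℕ (suc n)))                     ∎
    where
    open ≡-Reasoning
    u₀≈u₁ : EqOrAdj T (u zero) (u (suc zero))
    u₀≈u₁ = u-map {zero} {suc zero} (inj₁ refl)

    first : Path X (proj₁ (u zero)) (proj₁ (u (suc zero))) 1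
    first = segment (isMap (projectPath u u-map) {zero} {suc zero} (inj₁ refl))

    tail-map : IsGraphMap (I n) T (u ∘ suc)
    tail-map = ∘-isGraphMap {I n} {I (suc n)} {T} u-map suc-isGraphMap

    rest : Path X (proj₁ (u (suc zero))) (proj₁ (u (fromℕ (suc n)))) n
    rest = projectPath (u ∘ suc) tail-map

    split : map (projectPath u u-map) ≗ concat (map first) (map rest)
    split zero          = refl
    split (suc zero)    = refl
    split (suc (suc _)) = refl

  locInj : ∀ y {y₁ y₂} → N[ T ] y y₁ → N[ T ] y y₂ → proj₁ y₁ ≡ proj₁ y₂ → y₁ ≡ y₂
  locInj y (inj₁ refl) (inj₁ refl) _ = refl
  locInj y (inj₁ refl) (inj₂ (x∼x₂ , _)) x≡x₂ =
    ⊥-elim (IsSimpleGraph.irrefl s (subst (_∼_ X (proj₁ y)) (sym x≡x₂) x∼x₂))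
  locInj y (inj₂ (x∼x₁ , _)) (inj₁ refl) x₁≡x =
    ⊥-elim (IsSimpleGraph.irrefl s (subst (_∼_ X (proj₁ y)) x₁≡x x∼x₁))
  locInj (x , a) (inj₂ (x∼x₁ , refl)) (inj₂ (x∼x₁' , refl)) refl =
    cong (_ ,_) (hom-path₁-unique F (edge X s x∼x₁) (edge X s x∼x₁') a)

  locSurj : ∀ y {x'} → N[ X ] (proj₁ y) x' → Σ (V T) λ y' → N[ T ] y y' × proj₁ y' ≡ x'
  locSurj y (inj₁ refl) = y , inj₁ refl , refl
  locSurj (x , a) {x'} (inj₂ x∼x') = (x' , hom F (edge X s x∼x') a) , inj₂ (x∼x' , refl) , refl

  liftSquare : (u : V (I 3) → V T) (v : V I₁□I₁ → V X)
             → IsGraphMap (I 3) T u → IsGraphMap I₁□I₁ X v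
             → proj₁ (u (# 0)) ≡ v (# 1 , # 0)
             → proj₁ (u (# 1)) ≡ v (# 0 , # 0)
             → proj₁ (u (# 2)) ≡ v (# 0 , # 1)
             → proj₁ (u (# 3)) ≡ v (# 1 , # 1)
             → EqOrAdj T (u (# 0)) (u (# 3))
  liftSquare u v u-map v-map u₀≡v₁₀ u₁≡v₀₀ u₂≡v₀₁ u₃≡v₁₁ =
    hom≡⇒step x₀≈x₃ (segment x₀≈x₃)
      (trans (sym (hom-collapse₃ π x₀≈x₃ x₁≈x₀ x₂≈x₃ _)) (hom-projectPath 3 u u-map))
    where
    π : Path X (proj₁ (u (# 0))) (proj₁ (u (# 3))) 3
    π = projectPath u u-map

    x₀≈x₃ : EqOrAdj X (map π (# 0)) (map π (# 3))
    x₀≈x₃ = subst₂ (EqOrAdj X) (sym u₀≡v₁₀) (sym u₃≡v₁₁)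
              (v-map {# 1 , # 0} {# 1 , # 1} (inj₁ (refl , inj₁ refl)))

    x₁≈x₀ : EqOrAdj X (map π (# 1)) (map π (# 0))
    x₁≈x₀ = subst₂ (EqOrAdj X) (sym u₁≡v₀₀) (sym u₀≡v₁₀)
              (v-map {# 0 , # 0} {# 1 , # 0} (inj₂ (inj₁ refl , refl)))

    x₂≈x₃ : EqOrAdj X (map π (# 2)) (map π (# 3))
    x₂≈x₃ = subst₂ (EqOrAdj X) (sym u₂≡v₀₁) (sym u₃≡v₁₁)
              (v-map {# 0 , # 1} {# 1 , # 1} (inj₂ (inj₁ refl , refl)))

  proj-isCoveringMap : IsCoveringMap T X (proj X s F)
  proj-isCoveringMap = record
    { isGraphMap = proj-isGraphMap
    ; locInj     = locInj
    ; locSurj    = locSurj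
    ; square     = liftSquare
    }

proposition4p20 : (X : Graph) (s : IsSimpleGraph X) (F : Functor X)
    → IsSimpleGraph (Tot X s F) × IsCoveringMap (Tot X s F) X (proj X s F)
proposition4p20 X s F = Tot-isSimpleGraph X s F , proj-isCoveringMap X s F
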